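{- Let $G$ be a finite simple graph, let $I$ be a maximum critical independent set in $G$, and set $X=I\cup N(I)$. Then $\operatorname{diadem}(G)\cup N(\operatorname{diadem}(G)) = X$.
   Context: For $Y\subseteq V(G)$, $N(Y)=\bigcup_{u\in Y}N(u)$ and $d(Y)=|Y|-|N(Y)|$. A set is independent if no two of its vertices are adjacent. An independent set $A$ is critical if $d(A)=\max\{d(Y):Y\subseteq V(G)\}$; the empty set may be critical. A maximum critical independent set is a critical independent set of maximum cardinality. $\operatorname{diadem}(G)$ is the union of all maximum critical independent sets of $G$ (empty if $\emptyset$ is the only critical independent set). -}

module Defs where

open import Data.Nat using (ℕ) renaming (_≤_ to _≤ℕ_)
open import Data.Bool using (Bool; true; false; _∧_)
open import Data.Fin using (Fin)
open import Data.Fin.Subset using (Subset; _∈_; _∪_; ∣_∣)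
open import Data.Vec using (tabulate; lookup)
open import Data.List using (allFin)
open import Data.Bool.ListAction using (any)
open import Data.Integer using (ℤ; +_; _-_; _≤_)
open import Data.Product using (Σ; _×_; ∃)
open import Data.Sum using (_⊎_)
open import Relation.Binary.PropositionalEquality using (_≡_)
open import Relation.Unary using (Pred)
open import Level using (0ℓ)

record Graph (n : ℕ) : Set where
  field
    adj   : Fin n → Fin n → Bool
    sym   : ∀ u v → adj u v ≡ adj v u
    irrefl : ∀ v → adj v v ≡ false
open Graph public

module _ {n : ℕ} (G : Graph n) where

  N : Subset n → Subset n
  N Y = tabulate λ v → any (λ u → lookup Y u ∧ adj G u v) (allFin n)

  d : Subset n → ℤ
  d Y = + ∣ Y ∣ - + ∣ N Y ∣

  Independent : Subset n → Set
  Independent A = ∀ u v → u ∈ A → v ∈ A → adj G u v ≡ false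

  CriticalIndependent : Subset n → Set
  CriticalIndependent A = Independent A × (∀ Y → d Y ≤ d A)

  MaxCriticalIndependent : Subset n → Set
  MaxCriticalIndependent I =
    CriticalIndependent I × (∀ A → CriticalIndependent A → ∣ A ∣ ≤ℕ ∣ I ∣)

  diadem : Pred (Fin n) 0ℓ
  diadem v = Σ (Subset n) λ I → MaxCriticalIndependent I × v ∈ I

  NPred : Pred (Fin n) 0ℓ → Pred (Fin n) 0ℓ
  NPred S v = ∃ λ u → S u × adj G u v ≡ true

  diademClosure : Pred (Fin n) 0ℓ
  diademClosure v = diadem v ⊎ NPred diadem v

module Submission where

-- Let J be critical independent and X = I ∪ J.  The function d is supermodular, so unions
-- of critical sets are critical and X is critical.  Deleting from X its vertices that have a
-- neighbour in X does not decrease d, so Y = X ─ N(X) is critical as well, and d(Y) = d(X)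
-- forces N(Y) = N(X) ─ X.  Since Y has no neighbour in X, I ∪ Y is critical independent,
-- and the maximality of I gives Y ⊆ I.  Now every vertex of X ∪ N(X) lies in Y ⊆ I, in
-- N(Y) ⊆ N(I), or in X ∩ N(X), where a vertex of J ─ I has its neighbour in I because J is
-- independent.  Thus J ∪ N(J) ⊆ I ∪ N(I) for every maximum critical independent J; the
-- reverse inclusion holds because I is one of them.

open import Defs hiding (sym)
open import Data.Nat using (ℕ)
open import Data.Fin using (Fin)
open import Data.Fin.Subset using (Subset; _∈_; _∪_)
open import Function.Bundles using (_⇔_)

import Data.Nat as ℕ
import Data.Nat.Properties as ℕ
open import Data.Integer using (ℤ; +_; _+_; _-_; _⊖_; _≤_)
open import Data.Integer.Properties
  using ( ⊖-monoʳ-≥-≤; ⊖-monoʳ->-<; +-cancelˡ-⊖; [+m]-[+n]≡m⊖n; pos-+; <⇒≱; ≮⇒≥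
        ; +-mono-<-≤; +-comm; ≤-trans; ≤-reflexive; module ≤-Reasoning)
open import Data.Integer.Tactic.RingSolver using (solve-∀)
open import Data.Bool using (true; false; T)
open import Data.Bool.Properties using (T-≡; T-∧; ¬-not)
open import Data.Fin.Subset using (_∩_; _─_; _⊆_; ∣_∣)
open import Data.Fin.Subset.Properties
  using ( _∈?_; p⊂q⇒∣p∣<∣q∣; p⊆q⇒∣p∣≤∣q∣; x∈p∪q⁻; x∈p∪q⁺; x∈p∩q⁺; p∩q⊆p; p∩q⊆q
        ; p⊆p∪q; q⊆p∪q; p─q⊆p; x∈p∧x∉q⇒x∈p─q; ∩-comm)
open import Data.Vec using ([]; _∷_; here; there; lookup)
open import Data.Vec.Properties using (lookup∘tabulate; []=⇒lookup; lookup⇒[]=)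
open import Data.List using (allFin)
open import Data.List.Relation.Unary.Any using (satisfied)
open import Data.List.Relation.Unary.Any.Properties using (any⁺; any⁻)
open import Data.List.Membership.Propositional using (lose)
open import Data.List.Membership.Propositional.Properties using (∈-allFin)
open import Data.Product using (∃; _×_; _,_; proj₁)
open import Data.Sum using (inj₁; inj₂)
open import Relation.Nullary using (¬_; yes; no; contradiction)
open import Relation.Binary.PropositionalEquality
  using (_≡_; refl; sym; trans; cong; cong₂; subst; subst₂; module ≡-Reasoning)
open import Function.Bundles using (mk⇔; Equivalence)
open import Function.Base using (_∘_)

private
  variable
    n : ℕ

open Equivalence using (to; from)

∣p∪q∣+∣p∩q∣≡∣p∣+∣q∣ : (p q : Subset n) → ∣ p ∪ q ∣ ℕ.+ ∣ p ∩ q ∣ ≡ ∣ p ∣ ℕ.+ ∣ q ∣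
∣p∪q∣+∣p∩q∣≡∣p∣+∣q∣ []          []          = refl
∣p∪q∣+∣p∩q∣≡∣p∣+∣q∣ (true ∷ p)  (true ∷ q)  =
  cong ℕ.suc (trans (ℕ.+-suc _ _) (trans (cong ℕ.suc (∣p∪q∣+∣p∩q∣≡∣p∣+∣q∣ p q)) (sym (ℕ.+-suc _ _))))
∣p∪q∣+∣p∩q∣≡∣p∣+∣q∣ (true ∷ p)  (false ∷ q) = cong ℕ.suc (∣p∪q∣+∣p∩q∣≡∣p∣+∣q∣ p q)
∣p∪q∣+∣p∩q∣≡∣p∣+∣q∣ (false ∷ p) (true ∷ q)  =
  trans (cong ℕ.suc (∣p∪q∣+∣p∩q∣≡∣p∣+∣q∣ p q)) (sym (ℕ.+-suc _ _))
∣p∪q∣+∣p∩q∣≡∣p∣+∣q∣ (false ∷ p) (false ∷ q) = ∣p∪q∣+∣p∩q∣≡∣p∣+∣q∣ p q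

∣p∣≡∣p∩q∣+∣p─q∣ : (p q : Subset n) → ∣ p ∣ ≡ ∣ p ∩ q ∣ ℕ.+ ∣ p ─ q ∣
∣p∣≡∣p∩q∣+∣p─q∣ []          []          = refl
∣p∣≡∣p∩q∣+∣p─q∣ (true ∷ p)  (true ∷ q)  = cong ℕ.suc (∣p∣≡∣p∩q∣+∣p─q∣ p q)
∣p∣≡∣p∩q∣+∣p─q∣ (true ∷ p)  (false ∷ q) = trans (cong ℕ.suc (∣p∣≡∣p∩q∣+∣p─q∣ p q)) (sym (ℕ.+-suc _ _))
∣p∣≡∣p∩q∣+∣p─q∣ (false ∷ p) (true ∷ q)  = ∣p∣≡∣p∩q∣+∣p─q∣ p q
∣p∣≡∣p∩q∣+∣p─q∣ (false ∷ p) (false ∷ q) = ∣p∣≡∣p∩q∣+∣p─q∣ p q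

x∈p─q⇒x∉q : {x : Fin n} (p q : Subset n) → x ∈ p ─ q → ¬ x ∈ q
x∈p─q⇒x∉q (true ∷ p) (false ∷ q) here ()
x∈p─q⇒x∉q (_ ∷ p)    (_ ∷ q)     (there x∈p─q) (there x∈q) = x∈p─q⇒x∉q p q x∈p─q x∈q

p⊆q∧∣q∣≤∣p∣⇒q⊆p : {p q : Subset n} → p ⊆ q → ∣ q ∣ ℕ.≤ ∣ p ∣ → q ⊆ p
p⊆q∧∣q∣≤∣p∣⇒q⊆p {p = p} p⊆q ∣q∣≤∣p∣ {x} x∈q with x ∈? p
... | yes x∈p = x∈p
... | no  x∉p = contradiction ∣q∣≤∣p∣ (ℕ.<⇒≱ (p⊂q⇒∣p∣<∣q∣ (p⊆q , x , x∈q , x∉p)))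

⊖-+-⊖ : ∀ a b c e → (a ⊖ b) + (c ⊖ e) ≡ (a ℕ.+ c) ⊖ (b ℕ.+ e)
⊖-+-⊖ a b c e = begin
  (a ⊖ b) + (c ⊖ e)               ≡⟨ sym (cong₂ _+_ ([+m]-[+n]≡m⊖n a b) ([+m]-[+n]≡m⊖n c e)) ⟩
  (+ a - + b) + (+ c - + e)       ≡⟨ regroup (+ a) (+ b) (+ c) (+ e) ⟩
  (+ a + + c) - (+ b + + e)       ≡⟨ sym (cong₂ _-_ (pos-+ a c) (pos-+ b e)) ⟩
  + (a ℕ.+ c) - + (b ℕ.+ e)       ≡⟨ [+m]-[+n]≡m⊖n (a ℕ.+ c) (b ℕ.+ e) ⟩
  (a ℕ.+ c) ⊖ (b ℕ.+ e)           ∎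
  where
  open ≡-Reasoning
  regroup : ∀ (a b c e : ℤ) → (a - b) + (c - e) ≡ (a + c) - (b + e)
  regroup = solve-∀

⊖-cancelˡ-≤ : ∀ m {a b} → m ⊖ a ≤ m ⊖ b → b ℕ.≤ a
⊖-cancelˡ-≤ m m⊖a≤m⊖b = ℕ.≮⇒≥ λ a<b → <⇒≱ (⊖-monoʳ->-< m a<b) m⊖a≤m⊖b

module GraphProperties {n : ℕ} (G : Graph n) where

  Critical : Subset n → Set
  Critical A = ∀ Y → d G Y ≤ d G A

  N[_] : Subset n → Subset n
  N[ S ] = S ∪ N G S

  ∈N⁺ : ∀ {Y u v} → u ∈ Y → adj G u v ≡ true → v ∈ N G Y
  ∈N⁺ {Y} {u} {v} u∈Y uv = lookup⇒[]= v (N G Y) (T-≡ .to (subst T (sym (lookup∘tabulate _ v))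
    (any⁺ _ (lose (∈-allFin u) (T-∧ .from (T-≡ .from ([]=⇒lookup u∈Y) , T-≡ .from uv))))))

  ∈N⁻ : ∀ {Y v} → v ∈ N G Y → ∃ λ u → u ∈ Y × adj G u v ≡ true
  ∈N⁻ {Y} {v} v∈NY with satisfied (any⁻ _ (allFin n) (subst T (lookup∘tabulate _ v) (T-≡ .from ([]=⇒lookup v∈NY))))
  ... | u , Yu∧uv with T-∧ .to Yu∧uv
  ... | Yu , uv = u , lookup⇒[]= u Y (T-≡ .to Yu) , T-≡ .to uv

  N-mono : ∀ {S T} → S ⊆ T → N G S ⊆ N G T
  N-mono S⊆T v∈NS with ∈N⁻ v∈NS
  ... | u , u∈S , uv = ∈N⁺ (S⊆T u∈S) uv

  N-∪ : ∀ S T → N G (S ∪ T) ⊆ N G S ∪ N G T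
  N-∪ S T v∈N[S∪T] with ∈N⁻ v∈N[S∪T]
  ... | u , u∈S∪T , uv with x∈p∪q⁻ S T u∈S∪T
  ... | inj₁ u∈S = x∈p∪q⁺ (inj₁ (∈N⁺ u∈S uv))
  ... | inj₂ u∈T = x∈p∪q⁺ (inj₂ (∈N⁺ u∈T uv))

  N-∩ : ∀ S T → N G (S ∩ T) ⊆ N G S ∩ N G T
  N-∩ S T v∈N[S∩T] = x∈p∩q⁺ (N-mono (p∩q⊆p S T) v∈N[S∩T] , N-mono (p∩q⊆q S T) v∈N[S∩T])

  d≡⊖ : ∀ S → d G S ≡ ∣ S ∣ ⊖ ∣ N G S ∣
  d≡⊖ S = [+m]-[+n]≡m⊖n (∣ S ∣) (∣ N G S ∣)

  d-supermodular : ∀ S T → d G S + d G T ≤ d G (S ∪ T) + d G (S ∩ T)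
  d-supermodular S T = begin
    d G S + d G T                                   ≡⟨ cong₂ _+_ (d≡⊖ S) (d≡⊖ T) ⟩
    (∣ S ∣ ⊖ ∣ N G S ∣) + (∣ T ∣ ⊖ ∣ N G T ∣)           ≡⟨ ⊖-+-⊖ (∣ S ∣) (∣ N G S ∣) (∣ T ∣) (∣ N G T ∣) ⟩
    (∣ S ∣ ℕ.+ ∣ T ∣) ⊖ (∣ N G S ∣ ℕ.+ ∣ N G T ∣)       ≡⟨ cong (_⊖ (∣ N G S ∣ ℕ.+ ∣ N G T ∣)) (sym (∣p∪q∣+∣p∩q∣≡∣p∣+∣q∣ S T)) ⟩
    (∣ S ∪ T ∣ ℕ.+ ∣ S ∩ T ∣) ⊖ (∣ N G S ∣ ℕ.+ ∣ N G T ∣) ≤⟨ ⊖-monoʳ-≥-≤ (∣ S ∪ T ∣ ℕ.+ ∣ S ∩ T ∣) ∣N[S∪T]∣+∣N[S∩T]∣≤ ⟩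
    (∣ S ∪ T ∣ ℕ.+ ∣ S ∩ T ∣) ⊖ (∣ N G (S ∪ T) ∣ ℕ.+ ∣ N G (S ∩ T) ∣)
                                                      ≡⟨ sym (⊖-+-⊖ (∣ S ∪ T ∣) (∣ N G (S ∪ T) ∣) (∣ S ∩ T ∣) (∣ N G (S ∩ T) ∣)) ⟩
    (∣ S ∪ T ∣ ⊖ ∣ N G (S ∪ T) ∣) + (∣ S ∩ T ∣ ⊖ ∣ N G (S ∩ T) ∣)
                                                      ≡⟨ sym (cong₂ _+_ (d≡⊖ (S ∪ T)) (d≡⊖ (S ∩ T))) ⟩
    d G (S ∪ T) + d G (S ∩ T)                       ∎
    where
    open ≤-Reasoning
    ∣N[S∪T]∣+∣N[S∩T]∣≤ : ∣ N G (S ∪ T) ∣ ℕ.+ ∣ N G (S ∩ T) ∣ ℕ.≤ ∣ N G S ∣ ℕ.+ ∣ N G T ∣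
    ∣N[S∪T]∣+∣N[S∩T]∣≤ = ℕ.≤-trans (ℕ.+-mono-≤ (p⊆q⇒∣p∣≤∣q∣ (N-∪ S T)) (p⊆q⇒∣p∣≤∣q∣ (N-∩ S T)))
      (ℕ.≤-reflexive (∣p∪q∣+∣p∩q∣≡∣p∣+∣q∣ (N G S) (N G T)))

  critical-∪ : ∀ S T → Critical S → Critical T → Critical (S ∪ T)
  critical-∪ S T S-crit T-crit Y = ≤-trans (T-crit Y) dT≤d[S∪T]
    where
    dT≤d[S∪T] : d G T ≤ d G (S ∪ T)
    dT≤d[S∪T] = ≮⇒≥ λ d[S∪T]<dT → <⇒≱ (+-mono-<-≤ d[S∪T]<dT (S-crit (S ∩ T)))
      (≤-trans (≤-reflexive (+-comm (d G T) (d G S))) (d-supermodular S T))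

  X─NX-isolated : ∀ {X u v} → u ∈ X → v ∈ X ─ N G X → adj G u v ≡ false
  X─NX-isolated {X} u∈X v∈X─NX = ¬-not λ uv → x∈p─q⇒x∉q X (N G X) v∈X─NX (∈N⁺ u∈X uv)

  N[X─NX]⊆NX─X : ∀ X → N G (X ─ N G X) ⊆ N G X ─ X
  N[X─NX]⊆NX─X X {w} w∈N[X─NX] with ∈N⁻ w∈N[X─NX]
  ... | y , y∈X─NX , yw = x∈p∧x∉q⇒x∈p─q (∈N⁺ (p─q⊆p X (N G X) y∈X─NX) yw) λ w∈X →
    contradiction (trans (sym (X─NX-isolated w∈X y∈X─NX)) (trans (Graph.sym G w y) yw)) λ ()

  d≡∣X─NX∣⊖∣NX─X∣ : ∀ X → d G X ≡ ∣ X ─ N G X ∣ ⊖ ∣ N G X ─ X ∣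
  d≡∣X─NX∣⊖∣NX─X∣ X = begin
    d G X                                                         ≡⟨ d≡⊖ X ⟩
    ∣ X ∣ ⊖ ∣ N G X ∣                                               ≡⟨ cong₂ _⊖_ (∣p∣≡∣p∩q∣+∣p─q∣ X (N G X)) ∣NX∣≡ ⟩
    (∣ X ∩ N G X ∣ ℕ.+ ∣ X ─ N G X ∣) ⊖ (∣ X ∩ N G X ∣ ℕ.+ ∣ N G X ─ X ∣) ≡⟨ +-cancelˡ-⊖ (∣ X ∩ N G X ∣) _ _ ⟩
    ∣ X ─ N G X ∣ ⊖ ∣ N G X ─ X ∣                                   ∎
    where
    open ≡-Reasoning
    ∣NX∣≡ : ∣ N G X ∣ ≡ ∣ X ∩ N G X ∣ ℕ.+ ∣ N G X ─ X ∣
    ∣NX∣≡ = trans (∣p∣≡∣p∩q∣+∣p─q∣ (N G X) X) (cong (λ Z → ∣ Z ∣ ℕ.+ ∣ N G X ─ X ∣) (∩-comm (N G X) X))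

  d≤d[X─NX] : ∀ X → d G X ≤ d G (X ─ N G X)
  d≤d[X─NX] X = begin
    d G X                                   ≡⟨ d≡∣X─NX∣⊖∣NX─X∣ X ⟩
    ∣ X ─ N G X ∣ ⊖ ∣ N G X ─ X ∣             ≤⟨ ⊖-monoʳ-≥-≤ (∣ X ─ N G X ∣) (p⊆q⇒∣p∣≤∣q∣ (N[X─NX]⊆NX─X X)) ⟩
    ∣ X ─ N G X ∣ ⊖ ∣ N G (X ─ N G X) ∣       ≡⟨ sym (d≡⊖ (X ─ N G X)) ⟩
    d G (X ─ N G X)                         ∎
    where open ≤-Reasoning

  critical-X─NX : ∀ X → Critical X → Critical (X ─ N G X)
  critical-X─NX X X-crit Y = ≤-trans (X-crit Y) (d≤d[X─NX] X)

  critical⇒NX─X⊆N[X─NX] : ∀ X → Critical X → N G X ─ X ⊆ N G (X ─ N G X)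
  critical⇒NX─X⊆N[X─NX] X X-crit = p⊆q∧∣q∣≤∣p∣⇒q⊆p (N[X─NX]⊆NX─X X) (⊖-cancelˡ-≤ (∣ X ─ N G X ∣)
    (subst₂ _≤_ (d≡⊖ (X ─ N G X)) (d≡∣X─NX∣⊖∣NX─X∣ X) (X-crit (X ─ N G X))))

  independent-∪-X─NX : ∀ {I X} → Independent G I → I ⊆ X → Independent G (I ∪ (X ─ N G X))
  independent-∪-X─NX {I} {X} I-ind I⊆X u v u∈ v∈ with x∈p∪q⁻ I (X ─ N G X) u∈ | x∈p∪q⁻ I (X ─ N G X) v∈
  ... | inj₁ u∈I     | inj₁ v∈I     = I-ind u v u∈I v∈I
  ... | inj₁ u∈I     | inj₂ v∈X─NX  = X─NX-isolated (I⊆X u∈I) v∈X─NX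
  ... | inj₂ u∈X─NX  | inj₁ v∈I     = trans (Graph.sym G u v) (X─NX-isolated (I⊆X v∈I) u∈X─NX)
  ... | inj₂ u∈X─NX  | inj₂ v∈X─NX  = X─NX-isolated (p─q⊆p X (N G X) u∈X─NX) v∈X─NX

  X─NX⊆maxCritical : ∀ {I X} → MaxCriticalIndependent G I → I ⊆ X → Critical X → X ─ N G X ⊆ I
  X─NX⊆maxCritical {I} {X} ((I-ind , I-crit) , I-max) I⊆X X-crit = I∪Y⊆I ∘ q⊆p∪q I Y
    where
    Y = X ─ N G X
    I∪Y⊆I : I ∪ Y ⊆ I
    I∪Y⊆I = p⊆q∧∣q∣≤∣p∣⇒q⊆p (p⊆p∪q Y)
      (I-max (I ∪ Y) (independent-∪-X─NX I-ind I⊆X , critical-∪ I Y I-crit (critical-X─NX X X-crit)))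

  N[I∪J]⊆N[I] : ∀ {I J} → MaxCriticalIndependent G I → CriticalIndependent G J → N[ I ∪ J ] ⊆ N[ I ]
  N[I∪J]⊆N[I] {I} {J} I-max@((_ , I-crit) , _) (J-ind , J-crit) = N[X]⊆N[I]
    where
    X = I ∪ J
    X-crit : Critical X
    X-crit = critical-∪ I J I-crit J-crit
    Y⊆I : X ─ N G X ⊆ I
    Y⊆I = X─NX⊆maxCritical I-max (p⊆p∪q J) X-crit
    X∩NX⊆N[I] : ∀ {v} → v ∈ X → v ∈ N G X → v ∈ N[ I ]
    X∩NX⊆N[I] {v} v∈X v∈NX with x∈p∪q⁻ I J v∈X | ∈N⁻ v∈NX
    ... | inj₁ v∈I | _              = x∈p∪q⁺ (inj₁ v∈I)
    ... | inj₂ v∈J | u , u∈X , uv with x∈p∪q⁻ I J u∈X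
    ...   | inj₁ u∈I = x∈p∪q⁺ (inj₂ (∈N⁺ u∈I uv))
    ...   | inj₂ u∈J = contradiction (trans (sym uv) (J-ind u v u∈J v∈J)) λ ()
    N[X]⊆N[I] : N[ X ] ⊆ N[ I ]
    N[X]⊆N[I] {v} v∈N[X] with x∈p∪q⁻ X (N G X) v∈N[X]
    ... | inj₁ v∈X with v ∈? N G X
    ...   | yes v∈NX = X∩NX⊆N[I] v∈X v∈NX
    ...   | no v∉NX  = x∈p∪q⁺ (inj₁ (Y⊆I (x∈p∧x∉q⇒x∈p─q v∈X v∉NX)))
    N[X]⊆N[I] {v} v∈N[X] | inj₂ v∈NX with v ∈? X
    ...   | yes v∈X = X∩NX⊆N[I] v∈X v∈NX
    ...   | no v∉X  = x∈p∪q⁺ (inj₂ (N-mono Y⊆I (critical⇒NX─X⊆N[X─NX] X X-crit (x∈p∧x∉q⇒x∈p─q v∈NX v∉X))))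

lemma2p1 : (n : ℕ) (G : Graph n) (I : Subset n) →
    MaxCriticalIndependent G I →
    ∀ (v : Fin n) → (diademClosure G v ⇔ v ∈ (I ∪ N G I))
lemma2p1 n G I I-max v = mk⇔ diadem-closure⊆N[I] N[I]⊆diadem-closure
  where
  open GraphProperties G
  diadem-closure⊆N[I] : diademClosure G v → v ∈ N[ I ]
  diadem-closure⊆N[I] (inj₁ (J , J-max , v∈J)) =
    N[I∪J]⊆N[I] I-max (proj₁ J-max) (x∈p∪q⁺ (inj₁ (q⊆p∪q I J v∈J)))
  diadem-closure⊆N[I] (inj₂ (u , (J , J-max , u∈J) , uv)) =
    N[I∪J]⊆N[I] I-max (proj₁ J-max) (x∈p∪q⁺ (inj₂ (N-mono (q⊆p∪q I J) (∈N⁺ u∈J uv))))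
  N[I]⊆diadem-closure : v ∈ N[ I ] → diademClosure G v
  N[I]⊆diadem-closure v∈N[I] with x∈p∪q⁻ I (N G I) v∈N[I]
  ... | inj₁ v∈I = inj₁ (I , I-max , v∈I)
  ... | inj₂ v∈NI with ∈N⁻ v∈NI
  ... | u , u∈I , uv = inj₂ (u , (I , I-max , u∈I) , uv)
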